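{- If $T$ is a tree of order $n\ge 7$, then $\mathcal{C}(T)\le n-2$.
   Context: For a graph $G$ with vertex set $V$, a set $S\subseteq V$ is a dominating set if every vertex of $V\setminus S$ is adjacent to a vertex of $S$. Two disjoint sets $V_1,V_2\subseteq V$ form a coalition in $G$ if neither is a dominating set of $G$ but $V_1\cup V_2$ is. A coalition partition of $G$ is a partition $\Psi=\{V_1,\ldots,V_k\}$ of $V$ such that every $V_i\in\Psi$ is either a dominating set of $G$ with $|V_i|=1$, or is not a dominating set and forms a coalition with some $V_j\in\Psi$. The coalition number $\mathcal{C}(G)$ is the maximum cardinality of a coalition partition of $G$. The order is $n=|V|$. -}

module Defs where

open import Data.Nat using (ℕ; _≤_)
open import Data.Fin using (Fin)
open import Data.List using (List; length; take; _++_)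
open import Data.List.Relation.Unary.Unique.Propositional using (Unique)
open import Data.List.Relation.Unary.Linked using (Linked)
open import Data.Product using (Σ; ∃; _×_)
open import Data.Sum using (_⊎_)
open import Data.Empty using (⊥)
open import Relation.Nullary using (¬_)
open import Relation.Binary.PropositionalEquality using (_≡_; _≢_)
open import Function.Definitions using (Surjective)

record Graph (n : ℕ) : Set₁ where
  field
    Adj    : Fin n → Fin n → Set
    sym    : ∀ {u v} → Adj u v → Adj v u
    irrefl : ∀ {v} → ¬ Adj v v
open Graph public

module _ {n : ℕ} (G : Graph n) where

  data Walk : Fin n → Fin n → Set where
    [] : ∀ {v} → Walk v v
    _∷_ : ∀ {u w v} → Adj G u w → Walk w v → Walk u v

  Connected : Set
  Connected = ∀ u v → Walk u v

  -- A cycle: at least three distinct vertices v0,…,vk such that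
  -- v0 v1 … vk v0 is a closed walk.
  IsCycle : List (Fin n) → Set
  IsCycle vs = (3 ≤ length vs) × Unique vs × Linked (Adj G) (vs ++ take 1 vs)

  Acyclic : Set
  Acyclic = ¬ Σ (List (Fin n)) IsCycle

  IsTree : Set
  IsTree = Connected × Acyclic

  Dominating : (Fin n → Set) → Set
  Dominating S = ∀ v → ¬ S v → ∃ λ u → S u × Adj G u v

  Class : ∀ {k} → (Fin n → Fin k) → Fin k → Fin n → Set
  Class part i v = part v ≡ i

  _∪_ : (Fin n → Set) → (Fin n → Set) → Fin n → Set
  (S ∪ T) v = S v ⊎ T v

  IsSingleton : (Fin n → Set) → Set
  IsSingleton S = ∃ λ v → S v × (∀ w → S w → w ≡ v)

  FormCoalition : (Fin n → Set) → (Fin n → Set) → Set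
  FormCoalition S T = ¬ Dominating S × ¬ Dominating T × Dominating (S ∪ T)

  -- A partition of V into k (nonempty) classes, given by a surjective
  -- labelling, is a coalition partition.
  IsCoalitionPartition : (k : ℕ) → (Fin n → Fin k) → Set
  IsCoalitionPartition k part =
    Surjective _≡_ _≡_ part ×
    (∀ i → (Dominating (Class part i) × IsSingleton (Class part i))
         ⊎ (¬ Dominating (Class part i) ×
            ∃ λ j → j ≢ i × FormCoalition (Class part i) (Class part j)))

  CoalitionNumber≤ : ℕ → Set
  CoalitionNumber≤ m = ∀ k (part : Fin n → Fin k) → IsCoalitionPartition k part → k ≤ m

-- A partition with more than n − 2 classes consists of singletons and at most one pair. A
-- dominating class would be a universal vertex, and in a forest any dominating set missing it
-- contains all other vertices, which two small classes cannot do. So every class needs a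
-- partner. If some singleton {v} has a singleton partner {w}, then every further singleton
-- partners v or w (a small dominating set disjoint from {v, w} would leave at most one vertex
-- uncovered), yet in a forest a vertex that does not dominate alone has at most two domination
-- partners. Otherwise all singletons partner the pair {p, q}; a vertex u undominated by p and q
-- is then adjacent to every other vertex, and p and q can each carry only one further
-- neighbour.
module Submission where

open import Defs hiding (sym)
open import Data.Empty using (⊥; ⊥-elim)
open import Data.Fin using (Fin; zero; suc; fromℕ<)
open import Data.Fin.Properties using (_≟_; injective⇒≤; all?; any?; ¬∀⟶∃¬; ∀-cons)
open import Data.List using (List; []; _∷_; _++_; [_]; length; lookup)
open import Data.List.Membership.Propositional using (_∈_)
open import Data.List.Membership.Propositional.Properties using (∃∈-Any)
import Data.List.Membership.DecPropositional as DecMembership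
open import Data.List.Relation.Unary.All using (All; []; _∷_)
import Data.List.Relation.Unary.All as All
open import Data.List.Relation.Unary.All.Properties using (All¬⇒¬Any; ¬Any⇒All¬)
open import Data.List.Relation.Unary.AllPairs using ([]; _∷_)
open import Data.List.Relation.Unary.Any using (Any; here; there; index)
open import Data.List.Relation.Unary.Any.Properties using (lookup-index)
open import Data.List.Relation.Unary.Linked using (Linked; [-]; _∷_)
open import Data.List.Relation.Unary.Unique.Propositional using (Unique)
open import Data.Nat using (ℕ; zero; suc; _+_; _∸_; _≤_; _<_; _≤?_; s≤s; z≤n)
open import Data.Nat.Properties using (≤-trans; ≤-pred; m≤m+n; m≤n+m∸n; <⇒≱; ≰⇒>; ≮⇒≥; 1+n≰n)
open import Data.Product using (∃; ∃₂; _×_; _,_; proj₁; proj₂)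
open import Data.Sum using (_⊎_; inj₁; inj₂)
import Data.Sum as Sum
open import Function using (_∘_)
open import Function.Definitions using (Surjective)
open import Relation.Binary.PropositionalEquality
  using (_≡_; _≢_; refl; sym; trans; cong; subst; ≢-sym; module ≡-Reasoning)
open import Relation.Nullary using (¬_; Dec; yes; no; ¬?; _×-dec_; _→-dec_; ¬¬-excluded-middle)
open import Relation.Unary using (Decidable)

¬¬-∀-Fin : ∀ {m} {P : Fin m → Set} → (∀ i → ¬ ¬ P i) → ¬ ¬ (∀ i → P i)
¬¬-∀-Fin {zero} _ ¬∀ = ¬∀ λ ()
¬¬-∀-Fin {suc m} {P} ¬¬P ¬∀ =
  ¬¬P zero λ p₀ → ¬¬-∀-Fin {P = P ∘ suc} (¬¬P ∘ suc) λ ps → ¬∀ (∀-cons p₀ ps)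

¬¬-decidable : ∀ {m} (R : Fin m → Fin m → Set) → ¬ ¬ (∀ u v → Dec (R u v))
¬¬-decidable R = ¬¬-∀-Fin λ u → ¬¬-∀-Fin {P = λ v → Dec (R u v)} λ _ → ¬¬-excluded-middle

_∈?_ : ∀ {m} (x : Fin m) (L : List (Fin m)) → Dec (x ∈ L)
_∈?_ {m} = DecMembership._∈?_ (_≟_ {m})

covering-list-length : ∀ {m} (L : List (Fin m)) → (∀ x → x ∈ L) → m ≤ length L
covering-list-length L covers = injective⇒≤ {f = index ∘ covers} λ {x} {y} eq → begin
  x                           ≡⟨ lookup-index (covers x) ⟩
  lookup L (index (covers x)) ≡⟨ cong (lookup L) eq ⟩
  lookup L (index (covers y)) ≡⟨ sym (lookup-index (covers y)) ⟩
  y                           ∎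
  where open ≡-Reasoning

fresh : ∀ {m} (L : List (Fin m)) → length L < m → ∃ λ x → All (x ≢_) L
fresh {m} L |L|<m with all? (_∈? L)
... | yes covers = ⊥-elim (<⇒≱ |L|<m (covering-list-length L covers))
... | no ¬covers = let x , x∉L = ¬∀⟶∃¬ m _ (_∈? L) ¬covers in x , ¬Any⇒All¬ L x∉L

pigeonhole-⊎ : ∀ {A : Set} {P Q : A → Set} →
               (∀ {a b} → P a → P b → a ≡ b) → (∀ {a b} → Q a → Q b → a ≡ b) →
               ∀ {x y z} → x ≢ y → x ≢ z → y ≢ z → P x ⊎ Q x → P y ⊎ Q y → P z ⊎ Q z → ⊥
pigeonhole-⊎ P! Q! x≢y x≢z y≢z = λ where
  (inj₁ px) (inj₁ py) _ → x≢y (P! px py)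
  (inj₂ qx) (inj₂ qy) _ → x≢y (Q! qx qy)
  (inj₁ px) (inj₂ _) (inj₁ pz) → x≢z (P! px pz)
  (inj₁ _) (inj₂ qy) (inj₂ qz) → y≢z (Q! qy qz)
  (inj₂ _) (inj₁ py) (inj₁ pz) → y≢z (P! py pz)
  (inj₂ qx) (inj₁ _) (inj₂ qz) → x≢z (Q! qx qz)

module Domination {n : ℕ} (G : Graph n) where

  Dominating-mono : ∀ {S T : Fin n → Set} → (∀ {z} → S z → T z) → Dominating G S → Dominating G T
  Dominating-mono S⊆T dom v ¬Tv with dom v (¬Tv ∘ S⊆T)
  ... | u , Su , u~v = u , S⊆T Su , u~v

  dominator : ∀ {L y} → Dominating G (_∈ L) → All (y ≢_) L → Any (λ z → Adj G z y) L
  dominator dom y∉L = ∃∈-Any (dom _ (All¬⇒¬Any y∉L))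

  DominatingPair : Fin n → Fin n → Set
  DominatingPair a b = Dominating G (_∈ a ∷ b ∷ [])

  DominatingPair-comm : ∀ {a b} → DominatingPair a b → DominatingPair b a
  DominatingPair-comm = Dominating-mono λ { (here refl) → there (here refl) ; (there (here refl)) → here refl }

  dominating-singleton⇒universal : ∀ {S : Fin n → Set} {u} → Dominating G S → (∀ w → S w → w ≡ u) →
                                   ∀ {y} → y ≢ u → Adj G u y
  dominating-singleton⇒universal {S} {u} dom only {y} y≢u with dom y (y≢u ∘ only y)
  ... | z , Sz , z~y = subst (λ w → Adj G w y) (only z Sz) z~y

  module _ (adj? : ∀ u v → Dec (Adj G u v)) {S : Fin n → Set} (S? : Decidable S) where

    private
      Dominated : Fin n → Set
      Dominated v = ¬ S v → ∃ λ u → S u × Adj G u v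

      dominated? : Decidable Dominated
      dominated? v = ¬? (S? v) →-dec any? λ u → S? u ×-dec adj? u v

    undominated : ¬ Dominating G S → ∃ λ r → ¬ S r × (∀ {z} → S z → ¬ Adj G z r)
    undominated ¬dom with ¬∀⟶∃¬ n Dominated dominated? ¬dom
    ... | r , ¬dominated-r with S? r
    ... | yes Sr = ⊥-elim (¬dominated-r (λ ¬Sr → ⊥-elim (¬Sr Sr)))
    ... | no ¬Sr = r , ¬Sr , λ Sz z~r → ¬dominated-r (λ _ → _ , Sz , z~r)

module Forest {n : ℕ} (G : Graph n) (acyclic : Acyclic G) where

  open Domination G using (dominator; DominatingPair)

  infix 4 _~_
  _~_ : Fin n → Fin n → Set
  _~_ = Adj G

  ~-sym : ∀ {a b} → a ~ b → b ~ a
  ~-sym = Graph.sym G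

  ~⇒≢ : ∀ {a b} → a ~ b → a ≢ b
  ~⇒≢ a~b refl = Graph.irrefl G a~b

  no-cycle : ∀ {a b c} vs → Unique (a ∷ b ∷ c ∷ vs) → Linked _~_ (a ∷ b ∷ c ∷ vs ++ [ a ]) → ⊥
  no-cycle _ distinct closed = acyclic (_ , s≤s (s≤s (s≤s z≤n)) , distinct , closed)

  no-triangle : ∀ {a b c} → a ~ b → b ~ c → c ~ a → ⊥
  no-triangle ab bc ca =
    no-cycle [] ((~⇒≢ ab ∷ ≢-sym (~⇒≢ ca) ∷ []) ∷ (~⇒≢ bc ∷ []) ∷ [] ∷ []) (ab ∷ bc ∷ ca ∷ [-])

  no-square : ∀ {a b c d} → a ≢ c → b ≢ d → a ~ b → b ~ c → c ~ d → d ~ a → ⊥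
  no-square a≢c b≢d ab bc cd da =
    no-cycle (_ ∷ [])
      ((~⇒≢ ab ∷ a≢c ∷ ≢-sym (~⇒≢ da) ∷ []) ∷ (~⇒≢ bc ∷ b≢d ∷ []) ∷ (~⇒≢ cd ∷ []) ∷ [] ∷ [])
      (ab ∷ bc ∷ cd ∷ da ∷ [-])

  no-hexagon : ∀ {a b c d e f} → Unique (a ∷ b ∷ c ∷ d ∷ e ∷ f ∷ []) →
               a ~ b → b ~ c → c ~ d → d ~ e → e ~ f → f ~ a → ⊥
  no-hexagon distinct ab bc cd de ef fa = no-cycle (_ ∷ _ ∷ _ ∷ []) distinct (ab ∷ bc ∷ cd ∷ de ∷ ef ∷ fa ∷ [-])

  Path₃ : Fin n → Fin n → Fin n → Fin n → Set
  Path₃ s t x z = s ~ x × x ~ z × z ~ t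

  Path₃-unique : ∀ {s t x₁ z₁ x₂ z₂} → s ≢ t → s ≢ z₁ → s ≢ z₂ → x₁ ≢ t → x₂ ≢ t →
                 x₁ ≢ z₂ → x₂ ≢ z₁ → Path₃ s t x₁ z₁ → Path₃ s t x₂ z₂ → x₁ ≡ x₂
  Path₃-unique {z₁ = z₁} {x₂} {z₂} s≢t s≢z₁ s≢z₂ x₁≢t x₂≢t x₁≢z₂ x₂≢z₁
               (sx₁ , x₁z₁ , z₁t) (sx₂ , x₂z₂ , z₂t)
    with _ ≟ x₂ | z₁ ≟ z₂
  ... | yes x₁≡x₂ | _ = x₁≡x₂
  ... | no x₁≢x₂ | yes refl = ⊥-elim (no-square s≢z₁ x₁≢x₂ sx₁ x₁z₁ (~-sym x₂z₂) (~-sym sx₂))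
  ... | no x₁≢x₂ | no z₁≢z₂ = ⊥-elim (no-hexagon
        ((~⇒≢ sx₁ ∷ s≢z₁ ∷ s≢t ∷ s≢z₂ ∷ ~⇒≢ sx₂ ∷ []) ∷
         (~⇒≢ x₁z₁ ∷ x₁≢t ∷ x₁≢z₂ ∷ x₁≢x₂ ∷ []) ∷
         (~⇒≢ z₁t ∷ z₁≢z₂ ∷ ≢-sym x₂≢z₁ ∷ []) ∷
         (≢-sym (~⇒≢ z₂t) ∷ ≢-sym x₂≢t ∷ []) ∷
         (≢-sym (~⇒≢ x₂z₂) ∷ []) ∷ [] ∷ [])
        sx₁ x₁z₁ z₁t (~-sym z₂t) (~-sym x₂z₂) (~-sym sx₂))

  -- Each vertex y outside a, b and L lies on a path a–y–d–b or b–y–d–a with d ∈ L; two such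
  -- vertices would close a 4- or 6-cycle.
  module _ {a b : Fin n} {L : List (Fin n)} (a≢b : a ≢ b) (dom-ab : Dominating G (_∈ a ∷ b ∷ []))
           (dom-L : Dominating G (_∈ L)) (a∉L : All (a ≢_) L) (b∉L : All (b ≢_) L) where

    private
      Detour : Fin n → Set
      Detour y = ∃ λ d → d ∈ L × (Path₃ a b y d ⊎ Path₃ b a y d)

      detour : ∀ {y} → All (y ≢_) (a ∷ b ∷ L) → Detour y
      detour {y} (y≢a ∷ y≢b ∷ y∉L) with dom-L y (All¬⇒¬Any y∉L)
      ... | d , d∈L , dy
        with dominator dom-ab (y≢a ∷ y≢b ∷ []) | dominator dom-ab (d≢ a∉L ∷ d≢ b∉L ∷ [])
        where d≢ : ∀ {v} → All (v ≢_) L → d ≢ v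
              d≢ v∉L = ≢-sym (All.lookup v∉L d∈L)
      ... | here ay       | here ad       = ⊥-elim (no-triangle ay (~-sym dy) (~-sym ad))
      ... | here ay       | there (here bd) = d , d∈L , inj₁ (ay , ~-sym dy , ~-sym bd)
      ... | there (here by) | here ad       = d , d∈L , inj₂ (by , ~-sym dy , ~-sym ad)
      ... | there (here by) | there (here bd) = ⊥-elim (no-triangle by (~-sym dy) (~-sym bd))

      crossed : ∀ {y₁ y₂ d₁ d₂} → All (y₁ ≢_) (a ∷ b ∷ L) → y₂ ≢ a → d₁ ∈ L → d₂ ∈ L → y₁ ≢ y₂ →
                Path₃ a b y₁ d₁ → Path₃ b a y₂ d₂ → ⊥
      crossed {d₁ = d₁} {d₂} (_ ∷ y₁≢b ∷ y₁∉L) y₂≢a d₁∈L d₂∈L y₁≢y₂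
              p₁@(ay₁ , y₁d₁ , _) (by₂ , y₂d₂ , d₂a)
        with d₁ ≟ d₂
      ... | yes refl = no-triangle ay₁ y₁d₁ d₂a
      ... | no d₁≢d₂ = All.lookup y₁∉L d₂∈L
          (Path₃-unique a≢b (All.lookup a∉L d₁∈L) (≢-sym y₂≢a) y₁≢b (≢-sym (All.lookup b∉L d₂∈L))
                        y₁≢y₂ (≢-sym d₁≢d₂) p₁ (~-sym d₂a , ~-sym y₂d₂ , ~-sym by₂))

    outside-dominating-pair-and-set-unique : ∀ {y₁ y₂} → All (y₁ ≢_) (a ∷ b ∷ L) → All (y₂ ≢_) (a ∷ b ∷ L) →
                                             y₁ ≡ y₂
    outside-dominating-pair-and-set-unique {y₁} {y₂}
      y₁∉@(y₁≢a ∷ y₁≢b ∷ y₁∉L) y₂∉@(y₂≢a ∷ y₂≢b ∷ y₂∉L)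
      with y₁ ≟ y₂ | detour y₁∉ | detour y₂∉
    ... | yes y₁≡y₂ | _ | _ = y₁≡y₂
    ... | no _ | d₁ , d₁∈L , inj₁ p₁ | d₂ , d₂∈L , inj₁ p₂ =
      Path₃-unique a≢b (All.lookup a∉L d₁∈L) (All.lookup a∉L d₂∈L) y₁≢b y₂≢b
                   (All.lookup y₁∉L d₂∈L) (All.lookup y₂∉L d₁∈L) p₁ p₂
    ... | no _ | d₁ , d₁∈L , inj₂ p₁ | d₂ , d₂∈L , inj₂ p₂ =
      Path₃-unique (≢-sym a≢b) (All.lookup b∉L d₁∈L) (All.lookup b∉L d₂∈L) y₁≢a y₂≢a
                   (All.lookup y₁∉L d₂∈L) (All.lookup y₂∉L d₁∈L) p₁ p₂
    ... | no y₁≢y₂ | d₁ , d₁∈L , inj₁ p₁ | d₂ , d₂∈L , inj₂ p₂ =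
      ⊥-elim (crossed y₁∉ y₂≢a d₁∈L d₂∈L y₁≢y₂ p₁ p₂)
    ... | no y₁≢y₂ | d₁ , d₁∈L , inj₂ p₁ | d₂ , d₂∈L , inj₁ p₂ =
      ⊥-elim (crossed y₂∉ y₁≢a d₂∈L d₁∈L (≢-sym y₁≢y₂) p₂ p₁)

  -- Two partners a, b of v avoiding r are both adjacent to r and to v: a 4-cycle v a r b.
  module _ {v r : Fin n} (r≢v : r ≢ v) (v≁r : ¬ v ~ r) where

    private
      partner~r : ∀ {a} → DominatingPair v a → r ≢ a → a ~ r
      partner~r dom r≢a with dominator dom (r≢v ∷ r≢a ∷ [])
      ... | here v~r = ⊥-elim (v≁r v~r)
      ... | there (here a~r) = a~r

      v~partner : ∀ {a b} → DominatingPair v b → a ≢ v → a ≢ b → a ~ r → b ~ r → v ~ a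
      v~partner dom a≢v a≢b a~r b~r with dominator dom (a≢v ∷ a≢b ∷ [])
      ... | here v~a = v~a
      ... | there (here b~a) = ⊥-elim (no-triangle a~r (~-sym b~r) b~a)

      two-partners : ∀ {a b} → a ≢ b → a ≢ v → b ≢ v → r ≢ a → r ≢ b →
                     DominatingPair v a → DominatingPair v b → ⊥
      two-partners a≢b a≢v b≢v r≢a r≢b dom-a dom-b =
        no-square (≢-sym r≢v) a≢b (v~partner dom-b a≢v a≢b a~r b~r) a~r (~-sym b~r)
                  (~-sym (v~partner dom-a b≢v (≢-sym a≢b) b~r a~r))
        where a~r = partner~r dom-a r≢a
              b~r = partner~r dom-b r≢b

    other-partner-unique : ∀ {a y₁ y₂} → a ≢ v → DominatingPair v a →
                           All (y₁ ≢_) (v ∷ a ∷ []) × DominatingPair v y₁ →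
                           All (y₂ ≢_) (v ∷ a ∷ []) × DominatingPair v y₂ → y₁ ≡ y₂
    other-partner-unique {a} {y₁} {y₂} a≢v dom-a
                         (y₁≢v ∷ y₁≢a ∷ [] , dom-y₁) (y₂≢v ∷ y₂≢a ∷ [] , dom-y₂)
      with y₁ ≟ y₂ | r ≟ a | r ≟ y₁
    ... | yes y₁≡y₂ | _ | _ = y₁≡y₂
    ... | no y₁≢y₂ | yes refl | _ =
      ⊥-elim (two-partners y₁≢y₂ y₁≢v y₂≢v (≢-sym y₁≢a) (≢-sym y₂≢a) dom-y₁ dom-y₂)
    ... | no y₁≢y₂ | no r≢a | yes refl =
      ⊥-elim (two-partners (≢-sym y₂≢a) a≢v y₂≢v r≢a y₁≢y₂ dom-a dom-y₂)
    ... | no _ | no r≢a | no r≢y₁ =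
      ⊥-elim (two-partners (≢-sym y₁≢a) a≢v y₁≢v r≢a r≢y₁ dom-a dom-y₁)

  module _ {u p q : Fin n} (u≢p : u ≢ p) (u≢q : u ≢ q) (p≁u : ¬ p ~ u) (q≁u : ¬ q ~ u)
           (completes : ∀ {s} → All (s ≢_) (u ∷ p ∷ q ∷ []) → Dominating G (_∈ s ∷ p ∷ q ∷ [])) where

    private
      ~u : ∀ {s} → All (s ≢_) (u ∷ p ∷ q ∷ []) → s ~ u
      ~u {s} s∉@(s≢u ∷ _) with dominator (completes s∉) (≢-sym s≢u ∷ u≢p ∷ u≢q ∷ [])
      ... | here s~u = s~u
      ... | there (here p~u) = ⊥-elim (p≁u p~u)
      ... | there (there (here q~u)) = ⊥-elim (q≁u q~u)

      Hanging : Fin n → Fin n → Set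
      Hanging c s = All (s ≢_) (u ∷ p ∷ q ∷ []) × c ~ s

      hangs : ∀ {s s′} → s ≢ s′ → All (s ≢_) (u ∷ p ∷ q ∷ []) → All (s′ ≢_) (u ∷ p ∷ q ∷ []) →
              Hanging p s ⊎ Hanging q s
      hangs s≢s′ s∉@(_ ∷ s≢p ∷ s≢q ∷ []) s′∉ with dominator (completes s′∉) (s≢s′ ∷ s≢p ∷ s≢q ∷ [])
      ... | here s′~s = ⊥-elim (no-triangle s′~s (~u s∉) (~-sym (~u s′∉)))
      ... | there (here p~s) = inj₁ (s∉ , p~s)
      ... | there (there (here q~s)) = inj₂ (s∉ , q~s)

      hanging-unique : ∀ {c} → c ≢ u → ∀ {s s′} → Hanging c s → Hanging c s′ → s ≡ s′
      hanging-unique c≢u {s} {s′} (s∉ , c~s) (s′∉ , c~s′) with s ≟ s′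
      ... | yes s≡s′ = s≡s′
      ... | no s≢s′ = ⊥-elim (no-square c≢u s≢s′ c~s (~u s∉) (~-sym (~u s′∉)) (~-sym c~s′))

    every-vertex-completes-pair⇒n≤5 : n ≤ 5
    every-vertex-completes-pair⇒n≤5 = ≮⇒≥ three-outside
      where
      three-outside : ¬ 5 < n
      three-outside 6≤n
        with x₁ , x₁∉ ← fresh (u ∷ p ∷ q ∷ []) (≤-trans (m≤m+n 4 2) 6≤n)
        with x₂ , x₂≢x₁ ∷ x₂∉ ← fresh (x₁ ∷ u ∷ p ∷ q ∷ []) (≤-trans (m≤m+n 5 1) 6≤n)
        with x₃ , x₃≢x₂ ∷ x₃≢x₁ ∷ x₃∉ ← fresh (x₂ ∷ x₁ ∷ u ∷ p ∷ q ∷ []) 6≤n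
        = pigeonhole-⊎ (hanging-unique (≢-sym u≢p)) (hanging-unique (≢-sym u≢q))
                       (≢-sym x₂≢x₁) (≢-sym x₃≢x₁) (≢-sym x₃≢x₂)
                       (hangs (≢-sym x₂≢x₁) x₁∉ x₂∉) (hangs x₂≢x₁ x₂∉ x₁∉) (hangs x₃≢x₁ x₃∉ x₁∉)

  dominating-avoids-only-universal : ∀ {S : Fin n → Set} {u} → (∀ {y} → y ≢ u → u ~ y) →
                                     Dominating G S → ¬ S u → ∀ {y} → y ≢ u → ¬ ¬ S y
  dominating-avoids-only-universal universal dom ¬Su y≢u ¬Sy with dom _ ¬Sy
  ... | z , Sz , z~y = no-triangle (universal z≢u) z~y (~-sym (universal y≢u))
    where z≢u = λ { refl → ¬Su Sz }

module Partition {n k : ℕ} (part : Fin n → Fin k) (surjective : Surjective _≡_ _≡_ part) where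

  rep : Fin k → Fin n
  rep i = proj₁ (surjective i)

  part-rep : ∀ i → part (rep i) ≡ i
  part-rep i = proj₂ (surjective i) refl

  Alone : Fin n → Set
  Alone y = ∀ z → part z ≡ part y → z ≡ y

  alone? : Decidable Alone
  alone? y = all? λ z → (part z ≟ part y) →-dec (z ≟ y)

  classmate : ∀ {y} → ¬ Alone y → ∃ λ t → part t ≡ part y × t ≢ y
  classmate {y} ¬alone with ¬∀⟶∃¬ n _ (λ z → (part z ≟ part y) →-dec (z ≟ y)) ¬alone
  ... | t , ¬[t≡y] with part t ≟ part y | t ≟ y
  ... | yes pt≡py | no t≢y = t , pt≡py , t≢y
  ... | yes _ | yes t≡y = ⊥-elim (¬[t≡y] λ _ → t≡y)
  ... | no pt≢py | _ = ⊥-elim (¬[t≡y] λ pt≡py → ⊥-elim (pt≢py pt≡py))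

  Survives : Fin n → Fin n → Fin k → Set
  Survives b d i = ∃ λ t → part t ≡ i × All (t ≢_) (b ∷ d ∷ [])

  survives⇒2+k≤n : ∀ {b d} → b ≢ d → Survives b d (part b) → Survives b d (part d) → 2 + k ≤ n
  survives⇒2+k≤n {b} {d} b≢d (t , pt , t∉) (t′ , pt′ , t′∉) = injective⇒≤ g-injective
    where
    survivor : ∀ i → Survives b d i
    survivor i with rep i ≟ b | rep i ≟ d
    ... | yes refl | _ = t , trans pt (part-rep i) , t∉
    ... | no _ | yes refl = t′ , trans pt′ (part-rep i) , t′∉
    ... | no ≢b | no ≢d = rep i , part-rep i , ≢b ∷ ≢d ∷ []

    g : Fin (2 + k) → Fin n
    g zero = b
    g (suc zero) = d
    g (suc (suc i)) = proj₁ (survivor i)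

    ≢b : ∀ i → g (suc (suc i)) ≢ b
    ≢b i with survivor i
    ... | _ , _ , t≢b ∷ _ = t≢b

    ≢d : ∀ i → g (suc (suc i)) ≢ d
    ≢d i with survivor i
    ... | _ , _ , _ ∷ t≢d ∷ [] = t≢d

    g-injective : ∀ {x y} → g x ≡ g y → x ≡ y
    g-injective {zero} {zero} _ = refl
    g-injective {zero} {suc zero} b≡d = ⊥-elim (b≢d b≡d)
    g-injective {zero} {suc (suc j)} b≡gj = ⊥-elim (≢b j (sym b≡gj))
    g-injective {suc zero} {zero} d≡b = ⊥-elim (b≢d (sym d≡b))
    g-injective {suc zero} {suc zero} _ = refl
    g-injective {suc zero} {suc (suc j)} d≡gj = ⊥-elim (≢d j (sym d≡gj))
    g-injective {suc (suc i)} {zero} gi≡b = ⊥-elim (≢b i gi≡b)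
    g-injective {suc (suc i)} {suc zero} gi≡d = ⊥-elim (≢d i gi≡d)
    g-injective {suc (suc i)} {suc (suc j)} gi≡gj = cong (λ m → suc (suc m)) (begin
      i                            ≡⟨ proj₁ (proj₂ (survivor i)) ⟨
      part (proj₁ (survivor i))    ≡⟨ cong part gi≡gj ⟩
      part (proj₁ (survivor j))    ≡⟨ proj₁ (proj₂ (survivor j)) ⟩
      j                            ∎)
      where open ≡-Reasoning

  module NearlyDiscrete (few : n ≤ suc k) where

    alone-outside-classmates : ∀ {c t} → c ≢ t → part c ≡ part t → ∀ {y} → All (y ≢_) (c ∷ t ∷ []) → Alone y
    alone-outside-classmates {c} {t} c≢t pc≡pt {y} (y≢c ∷ y≢t ∷ []) with alone? y
    ... | yes alone = alone
    ... | no ¬alone with classmate ¬alone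
    ... | y′ , py′ , y′≢y = ⊥-elim (1+n≰n (≤-trans (survives⇒2+k≤n (≢-sym y≢c) c-survives y-survives) few))
      where
      c-survives : Survives c y (part c)
      c-survives = t , sym pc≡pt , ≢-sym c≢t ∷ ≢-sym y≢t ∷ []
      y-survives : Survives c y (part y)
      y-survives with y′ ≟ c
      ... | yes refl = t , trans (sym pc≡pt) py′ , ≢-sym c≢t ∷ ≢-sym y≢t ∷ []
      ... | no y′≢c = y′ , py′ , y′≢c ∷ y′≢y ∷ []

    alone-outside-some-pair : Fin n → ∃₂ λ p q → ∀ {y} → All (y ≢_) (p ∷ q ∷ []) → Alone y
    alone-outside-some-pair v with all? alone?
    ... | yes all-alone = v , v , λ _ → all-alone _
    ... | no ¬all-alone with ¬∀⟶∃¬ n Alone alone? ¬all-alone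
    ... | p , ¬alone with classmate ¬alone
    ... | q , pq≡pp , q≢p = p , q , alone-outside-classmates (≢-sym q≢p) (sym pq≡pp)

    ¬alone⇒classmates : ∀ {c t} → c ≢ t → part c ≡ part t → ∀ {y} → ¬ Alone y → y ∈ c ∷ t ∷ []
    ¬alone⇒classmates {c} {t} c≢t pc≡pt {y} ¬alone with y ≟ c | y ≟ t
    ... | yes y≡c | _ = here y≡c
    ... | no _ | yes y≡t = there (here y≡t)
    ... | no y≢c | no y≢t = ⊥-elim (¬alone (alone-outside-classmates c≢t pc≡pt (y≢c ∷ y≢t ∷ [])))

    class-of-classmates : ∀ {c t} → c ≢ t → part c ≡ part t → ∀ {z} → part z ≡ part c → z ∈ c ∷ t ∷ []
    class-of-classmates {c} c≢t pc≡pt {z} pz with z ≟ c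
    ... | yes z≡c = here z≡c
    ... | no z≢c = ¬alone⇒classmates c≢t pc≡pt λ alone → z≢c (sym (alone c (sym pz)))

    class-within-pair : ∀ j → ∃₂ λ m₁ m₂ → part m₁ ≡ j × part m₂ ≡ j ×
                                           (∀ {z} → part z ≡ j → z ∈ m₁ ∷ m₂ ∷ [])
    class-within-pair j with alone? (rep j)
    ... | yes alone = rep j , rep j , part-rep j , part-rep j , λ pz → here (alone _ (trans pz (sym (part-rep j))))
    ... | no ¬alone with classmate ¬alone
    ... | t , pt , t≢r = rep j , t , part-rep j , trans pt (part-rep j) ,
                         λ pz → class-of-classmates (≢-sym t≢r) (sym pt) (trans pz (sym (part-rep j)))

module LargeCoalitionPartition {n k : ℕ} {G : Graph n} (acyclic : Acyclic G) (adj? : ∀ u v → Dec (Adj G u v))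
                               {part : Fin n → Fin k} (coalition : IsCoalitionPartition G k part)
                               (few : n ≤ suc k) (7≤n : 7 ≤ n) where

  open Domination G
  open Forest G acyclic
  open Partition part (proj₁ coalition)
  open NearlyDiscrete few

  C : Fin k → Fin n → Set
  C = Class G part

  C? : ∀ i → Decidable (C i)
  C? i y = part y ≟ i

  no-dominating-class : ∀ i → ¬ Dominating G (C i)
  no-dominating-class i dom with proj₂ coalition i
  ... | inj₂ (¬dom , _) = ¬dom dom
  ... | inj₁ (_ , u , pu , only) with fresh (u ∷ []) (≤-trans (m≤m+n 2 5) 7≤n)
  ... | x₀ , x₀≢u ∷ [] with proj₂ coalition (part x₀)
  ... | inj₁ (dom₀ , _ , _ , only₀)
        with t , t≢x₀ ∷ t≢u ∷ [] ← fresh (x₀ ∷ u ∷ []) (≤-trans (m≤m+n 3 4) 7≤n)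
        = no-triangle (universal x₀≢u) (universal₀ t≢x₀) (~-sym (universal t≢u))
    where
    universal = dominating-singleton⇒universal dom only
    universal₀ = dominating-singleton⇒universal dom₀ λ w pw → trans (only₀ w pw) (sym (only₀ x₀ refl))
  ... | inj₂ (¬dom₀ , j , _ , _ , ¬domj , dom∪) = <⇒≱ (≤-trans (m≤m+n 4 2) 6≤k) (covering-list-length _ among)
    where
    6≤k : 6 ≤ k
    6≤k = ≤-pred (≤-trans 7≤n few)
    u∉∪ : ¬ (C (part x₀) u ⊎ C j u)
    u∉∪ (inj₁ pu≡px₀) = ¬dom₀ (subst (λ i′ → Dominating G (C i′)) (trans (sym pu) pu≡px₀) dom)
    u∉∪ (inj₂ pu≡j) = ¬domj (subst (λ i′ → Dominating G (C i′)) (trans (sym pu) pu≡j) dom)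
    among : ∀ ι → ι ∈ i ∷ part x₀ ∷ j ∷ []
    among ι with rep ι ≟ u | part (rep ι) ≟ part x₀ | part (rep ι) ≟ j
    ... | yes refl | _ | _ = here (trans (sym (part-rep ι)) pu)
    ... | no _ | yes p≡px₀ | _ = there (here (trans (sym (part-rep ι)) p≡px₀))
    ... | no _ | no _ | yes p≡j = there (there (here (trans (sym (part-rep ι)) p≡j)))
    ... | no r≢u | no p≢px₀ | no p≢j =
      ⊥-elim (dominating-avoids-only-universal (dominating-singleton⇒universal dom only) dom∪ u∉∪ r≢u
               λ { (inj₁ p≡px₀) → p≢px₀ p≡px₀ ; (inj₂ p≡j) → p≢j p≡j })

  private
    partnership : ∀ i → ∃ λ j → j ≢ i × Dominating G (_∪_ G (C i) (C j))
    partnership i with proj₂ coalition i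
    ... | inj₁ (dom , _) = ⊥-elim (no-dominating-class i dom)
    ... | inj₂ (_ , j , j≢i , _ , _ , dom∪) = j , j≢i , dom∪

  partner : Fin k → Fin k
  partner i = proj₁ (partnership i)

  partner-≢ : ∀ i → partner i ≢ i
  partner-≢ i = proj₁ (proj₂ (partnership i))

  partner-dominating : ∀ i → Dominating G (_∪_ G (C i) (C (partner i)))
  partner-dominating i = proj₂ (proj₂ (partnership i))

  undominated-by-class : ∀ i → ∃ λ r → part r ≢ i × (∀ {z} → part z ≡ i → ¬ z ~ r)
  undominated-by-class i = undominated adj? (C? i) (no-dominating-class i)

  alone-union-dominating : ∀ {x a b} → Alone x → (∀ {z} → part z ≡ partner (part x) → z ∈ a ∷ b ∷ []) →
                           Dominating G (_∈ x ∷ a ∷ b ∷ [])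
  alone-union-dominating x-alone within = Dominating-mono
    (λ { (inj₁ pz) → here (x-alone _ pz) ; (inj₂ pz) → there (within pz) }) (partner-dominating _)

  module _ {v : Fin n} (v-alone : Alone v) (w-alone : Alone (rep (partner (part v)))) where

    private
      w : Fin n
      w = rep (partner (part v))

      v≢w : v ≢ w
      v≢w v≡w = partner-≢ (part v) (trans (sym (part-rep _)) (cong part (sym v≡w)))

      alone-pair-dominating : ∀ {x y} → Alone x → Alone y → partner (part x) ≡ part y → DominatingPair x y
      alone-pair-dominating x-alone y-alone j≡py = Dominating-mono
        (λ { (here z≡x) → here z≡x
           ; (there (here z≡y)) → there (here z≡y)
           ; (there (there (here z≡y))) → there (here z≡y) })
        (alone-union-dominating x-alone λ pz → here (y-alone _ (trans pz j≡py)))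

      dom-vw : DominatingPair v w
      dom-vw = alone-pair-dominating v-alone w-alone (sym (part-rep _))

      side : ∀ {x} → Alone x → All (x ≢_) (v ∷ w ∷ []) → DominatingPair v x ⊎ DominatingPair w x
      side {x} x-alone (x≢v ∷ x≢w ∷ []) with partner (part x) ≟ part v | partner (part x) ≟ part w
      ... | yes j≡pv | _ = inj₁ (DominatingPair-comm (alone-pair-dominating x-alone v-alone j≡pv))
      ... | no _ | yes j≡pw = inj₂ (DominatingPair-comm (alone-pair-dominating x-alone w-alone j≡pw))
      ... | no j≢pv | no j≢pw with class-within-pair (partner (part x))
      ... | m₁ , m₂ , pm₁ , pm₂ , within
        with y₁ , y₁∉ ← fresh (v ∷ w ∷ x ∷ m₁ ∷ m₂ ∷ []) (≤-trans (m≤m+n 6 1) 7≤n)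
        with y₂ , y₂≢y₁ ∷ y₂∉ ← fresh (y₁ ∷ v ∷ w ∷ x ∷ m₁ ∷ m₂ ∷ []) 7≤n
        = ⊥-elim (y₂≢y₁ (sym (outside-dominating-pair-and-set-unique v≢w dom-vw (alone-union-dominating x-alone within)
                                (≢-sym x≢v ∷ outside pm₁ j≢pv ∷ outside pm₂ j≢pv ∷ [])
                                (≢-sym x≢w ∷ outside pm₁ j≢pw ∷ outside pm₂ j≢pw ∷ []) y₁∉ y₂∉)))
        where
        outside : ∀ {m a} → part m ≡ partner (part x) → partner (part x) ≢ part a → a ≢ m
        outside pm j≢pa a≡m = j≢pa (trans (sym pm) (cong part (sym a≡m)))

    alone-partners-impossible : ⊥
    alone-partners-impossible
      with r , pr≢pv , v≁r ← undominated-by-class (part v)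
      with r′ , pr′≢pw , w≁r′ ← undominated-by-class (part w)
      with p , q , alone-outside ← alone-outside-some-pair v
      with x₁ , x₁∉ ← fresh (v ∷ w ∷ p ∷ q ∷ []) (≤-trans (m≤m+n 5 2) 7≤n)
      with x₂ , x₂≢x₁ ∷ x₂∉ ← fresh (x₁ ∷ v ∷ w ∷ p ∷ q ∷ []) (≤-trans (m≤m+n 6 1) 7≤n)
      with x₃ , x₃≢x₂ ∷ x₃≢x₁ ∷ x₃∉ ← fresh (x₂ ∷ x₁ ∷ v ∷ w ∷ p ∷ q ∷ []) 7≤n
      = pigeonhole-⊎ (other-partner-unique (pr≢pv ∘ cong part) (v≁r refl) (≢-sym v≢w) dom-vw)
                     (other-partner-unique (pr′≢pw ∘ cong part) (w≁r′ refl) v≢w (DominatingPair-comm dom-vw))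
                     (≢-sym x₂≢x₁) (≢-sym x₃≢x₁) (≢-sym x₃≢x₂)
                     (partner-of x₁∉) (partner-of x₂∉) (partner-of x₃∉)
      where
      partner-of : ∀ {x} → All (x ≢_) (v ∷ w ∷ p ∷ q ∷ []) →
                   (All (x ≢_) (v ∷ w ∷ []) × DominatingPair v x) ⊎ (All (x ≢_) (w ∷ v ∷ []) × DominatingPair w x)
      partner-of (x≢v ∷ x≢w ∷ x∉pq) =
        Sum.map (x≢v ∷ x≢w ∷ [] ,_) (x≢w ∷ x≢v ∷ [] ,_) (side (alone-outside x∉pq) (x≢v ∷ x≢w ∷ []))

  module _ (partner-crowded : ∀ {x} → Alone x → ¬ Alone (rep (partner (part x)))) where

    crowded-partners-impossible : ⊥
    crowded-partners-impossible
      with p , q , alone-outside ← alone-outside-some-pair (fromℕ< (≤-trans (s≤s z≤n) 7≤n))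
      with x , x∉pq ← fresh (p ∷ q ∷ []) (≤-trans (m≤m+n 3 4) 7≤n)
      with t , pt≡pc , t≢c ← classmate (partner-crowded (alone-outside x∉pq))
      with u , pu≢pc , c≁u ← undominated-by-class (part (rep (partner (part x))))
      = <⇒≱ (≤-trans (m≤m+n 6 1) 7≤n)
            (every-vertex-completes-pair⇒n≤5 (pu≢pc ∘ cong part) (λ u≡t → pu≢pc (trans (cong part u≡t) pt≡pc))
                                              (c≁u refl) (c≁u pt≡pc) completes)
      where
      c = rep (partner (part x))
      partner-class : ∀ {y} → Alone y → partner (part y) ≡ part c
      partner-class y-alone with ¬alone⇒classmates (≢-sym t≢c) (sym pt≡pc) (partner-crowded y-alone)
      ... | here r≡c = trans (sym (part-rep _)) (cong part r≡c)
      ... | there (here r≡t) = trans (sym (part-rep _)) (trans (cong part r≡t) pt≡pc)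
      completes : ∀ {s} → All (s ≢_) (u ∷ c ∷ t ∷ []) → Dominating G (_∈ s ∷ c ∷ t ∷ [])
      completes (_ ∷ s∉ct) = alone-union-dominating s-alone
        λ pz → class-of-classmates (≢-sym t≢c) (sym pt≡pc) (trans pz (partner-class s-alone))
        where s-alone = alone-outside-classmates (≢-sym t≢c) (sym pt≡pc) s∉ct

  absurd : ⊥
  absurd with any? (λ x → alone? x ×-dec alone? (rep (partner (part x))))
  ... | yes (_ , v-alone , w-alone) = alone-partners-impossible v-alone w-alone
  ... | no ¬alone-partners = crowded-partners-impossible λ x-alone w-alone → ¬alone-partners (_ , x-alone , w-alone)

corollary3 : (n : ℕ) → 7 ≤ n → (T : Graph n) → IsTree T → CoalitionNumber≤ T (n ∸ 2)
corollary3 n 7≤n T (_ , acyclic) k part coalition with k ≤? n ∸ 2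
... | yes k≤n∸2 = k≤n∸2
-- Adjacency need not be decidable, but as the goal is now ⊥ we may assume it is.
... | no k≰n∸2 = ⊥-elim (¬¬-decidable (Adj T) λ adj? →
                   LargeCoalitionPartition.absurd {G = T} acyclic adj? coalition few 7≤n)
  where
  few : n ≤ suc k
  few = ≤-trans (m≤n+m∸n n 2) (s≤s (≰⇒> k≰n∸2))
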